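{- Let $H$ be a finite simple graph containing vertices $u$, $v$, $x$ with $N_H(u)=\{x,v\}$ and $N_H(v)=\{u\}$, and let $H'=H-\{u,v\}$. If $\varepsilon(H')$ is pancyclic, then $\varepsilon(H)$ is pancyclic.
   Context: All graphs are finite and simple. A dominating set of a graph $G$ is a set $D\subseteq V(G)$ such that every vertex of $V(G)\setminus D$ has a neighbour in $D$. The TARS-graph $\varepsilon(G)$ has as vertices the dominating sets of $G$; two distinct dominating sets $X,Y$ are adjacent iff either (i) $Y$ is obtained from $X$ by adding or deleting a single vertex of $G$, or (ii) there are vertices $u\in X$ and $v\in Y\setminus X$ that are adjacent in $G$ with $Y=(X\cup\{v\})\setminus\{u\}$. A graph on $N$ vertices is pancyclic if it contains a cycle of length $\ell$ for every integer $\ell$ with $3\le \ell\le N$. $G-S$ denotes the subgraph induced by deleting the vertices of $S$. -}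

module Defs where

open import Data.Nat using (ℕ; zero; suc; _≤_)
open import Data.Bool using (Bool; true; false)
open import Data.Bool.Properties using () renaming (_≟_ to _≟ᵇ_)
open import Data.Fin using (Fin; zero; suc; inject₁; fromℕ)
open import Data.Fin.Properties using (any?; all?)
open import Data.Fin.Subset using (Subset; _∈_; _∉_; _∪_; ⁅_⁆; _─_)
open import Data.Fin.Subset.Properties using (_∈?_)
open import Data.Vec using ([]; _∷_)
open import Data.List using (List; []; _∷_; _++_; map; filter; length)
open import Data.Product using (Σ; ∃; ∃-syntax; _×_; _,_)
open import Data.Sum using (_⊎_)
open import Relation.Nullary using (¬_; Dec)
open import Relation.Nullary.Decidable using (_×-dec_; _→-dec_; ¬?)
open import Relation.Binary.PropositionalEquality using (_≡_; _≢_)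
open import Function.Definitions using (Injective)

record Graph (n : ℕ) : Set where
  field
    adj    : Fin n → Fin n → Bool
    sym    : ∀ i j → adj i j ≡ adj j i
    irrefl : ∀ i → adj i i ≡ false

open Graph public

Adj : ∀ {n} → Graph n → Fin n → Fin n → Set
Adj G a b = adj G a b ≡ true

Dominating : ∀ {n} → Graph n → Subset n → Set
Dominating G D = ∀ w → w ∉ D → ∃[ z ] (z ∈ D × Adj G w z)

TARSAdj : ∀ {n} → Graph n → Subset n → Subset n → Set
TARSAdj G X Y =
  X ≢ Y ×
  ( (∃[ w ] (w ∉ X × Y ≡ X ∪ ⁅ w ⁆))
  ⊎ (∃[ w ] (w ∈ X × Y ≡ X ─ ⁅ w ⁆))
  ⊎ (∃[ a ] ∃[ b ] (a ∈ X × b ∈ Y × b ∉ X × Adj G a b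
        × Y ≡ (X ∪ ⁅ b ⁆) ─ ⁅ a ⁆)) )

allSubsets : ∀ n → List (Subset n)
allSubsets zero = [] ∷ []
allSubsets (suc n) = map (true ∷_) (allSubsets n) ++ map (false ∷_) (allSubsets n)

dominating? : ∀ {n} (G : Graph n) (D : Subset n) → Dec (Dominating G D)
dominating? G D =
  all? (λ w → ¬? (w ∈? D) →-dec any? (λ z → (z ∈? D) ×-dec (adj G w z ≟ᵇ true)))

-- number of dominating sets of G = number of vertices of ε(G)
numDominating : ∀ {n} → Graph n → ℕ
numDominating {n} G = length (filter (dominating? G) (allSubsets n))

-- A cycle of length suc k (k ≥ 2 enforced by callers) in ε(G):
-- pairwise distinct dominating sets c 0, …, c k, consecutive ones
-- TARS-adjacent, and c k TARS-adjacent to c 0.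
record TARSCycle {n} (G : Graph n) (k : ℕ) : Set where
  field
    c        : Fin (suc k) → Subset n
    dom      : ∀ i → Dominating G (c i)
    distinct : Injective _≡_ _≡_ c
    step     : ∀ (i : Fin k) → TARSAdj G (c (inject₁ i)) (c (suc i))
    close    : TARSAdj G (c (fromℕ k)) (c zero)

TARSPancyclic : ∀ {n} → Graph n → Set
TARSPancyclic G = ∀ k → 3 ≤ suc k → suc k ≤ numDominating G → TARSCycle G k

induced : ∀ {n m} → Graph n → (Fin m → Fin n) → Graph m
induced G f = record
  { adj = λ i j → adj G (f i) (f j)
  ; sym = λ i j → sym G (f i) (f j)
  ; irrefl = λ i → irrefl G (f i) }

-- f enumerates exactly the vertices of Fin n other than u and v
-- (so induced G f is G - {u, v}, up to relabelling of vertices).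
EnumeratesWithout : ∀ {n m} → (Fin m → Fin n) → Fin n → Fin n → Set
EnumeratesWithout {n} f u v =
  Injective _≡_ _≡_ f × (∀ i → f i ≢ u × f i ≢ v)
  × (∀ (w : Fin n) → w ≢ u → w ≢ v → ∃[ i ] f i ≡ w)

{-# OPTIONS --safe #-}
-- Relabel the vertices so that u and v become 0 and 1 and the vertex i of H′ = H - {u, v} becomes
-- 2 + i; a set of vertices of H is then a ∷ b ∷ S with S a set of vertices of H′. As v is adjacent
-- to u only, a dominating set of H contains u or v. If it contains v but not u it is dominating iff S
-- dominates H′; if it contains u, iff S dominates every vertex of H′ other than x. Such an S either
-- dominates H′ or is T - x for a detour set T: a dominating set of H′ containing x with T - x not
-- dominating. So every dominating set of H lies over exactly one dominating set T of H′, as one of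
-- the three lifts of T or, when T is a detour set, one of the two u-lifts of T - x.
-- Pancyclicity of ε(H′) gives a Hamiltonian path T₀, …, T_N of ε(H′). A cycle of ε(H) runs forward
-- through the v-lifts of T₀, …, T_j, turns into the u-lifts and returns to T₀, spending one, two or
-- (at a detour set, through T - x) four vertices at each Tᵢ; these choices realise every length
-- from 3 up to the number of dominating sets of H.
module Submission where

open import Defs hiding (sym; irrefl)
open import Data.Bool using (Bool; true; false; not; _∨_)
open import Data.Bool.Properties using (∨-identityʳ; not-¬) renaming (_≟_ to _≟ᵇ_)
open import Data.Fin using (Fin; zero; suc; inject₁; fromℕ)
open import Data.Fin.Properties using (_≟_; all?; any?; ¬∀⟶∃¬)
open import Data.Fin.Subset using (Subset; _∈_; _∉_; _⊆_; _∪_; _─_; _-_; ⁅_⁆; ⊤; outside; inside)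
open import Data.Fin.Subset.Properties
  using ( _∈?_; ∈⊤; ⊆⊤; ⊆-antisym; drop-there; x∈⁅x⁆; x∈⁅y⁆⇒x≡y; p⊆p∪q; q⊆p∪q; x∈p∪q⁻; ∪-identityʳ
        ; p─q⊆p; p─⊥≡p; x∈p∧x≢y⇒x∈p-y)
open import Data.Vec as Vec using ([]; _∷_; tabulate; here; there)
open import Data.Vec.Properties
  using ( ≡-dec; ∷-injectiveˡ; ∷-injectiveʳ; lookup⇒[]=; []=⇒lookup; lookup∘tabulate; tabulate∘lookup
        ; tabulate-cong; lookup-zipWith)
open import Data.List as List using (List; []; _∷_; _++_; length; lookup; filter; map)
open import Data.List.Properties using (length-++; length-map; length-tabulate)
open import Data.List.Membership.Propositional using (find) renaming (_∈_ to _∈ₗ_; _∉_ to _∉ₗ_)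
open import Data.List.Membership.Propositional.Properties
  using (∈-∃++; ∈-lookup; ∈-++⁺ˡ; ∈-++⁺ʳ; ∈-++⁻; ∈-map⁺; ∈-map⁻; ∈-filter⁺; ∈-filter⁻)
open import Data.List.Relation.Unary.Any as Any using (Any; here; there)
open import Data.List.Relation.Unary.All as All using (All; []; _∷_)
import Data.List.Relation.Unary.All.Properties as Allₚ
open import Data.List.Relation.Unary.All.Properties using (All¬⇒¬Any; ¬Any⇒All¬)
open import Data.List.Relation.Unary.Unique.Propositional using (Unique; []; _∷_)
import Data.List.Relation.Unary.Unique.Propositional.Properties as Unique
open import Data.Nat using (ℕ; zero; suc; _+_; _∸_; _≤_; _≤?_; z≤n; s≤s; s≤s⁻¹)
open import Data.Nat.Properties
  using ( ≤-refl; ≤-trans; ≤-reflexive; <-irrefl; ≰⇒>; m≤n⇒m<n∨m≡n; m+[n∸m]≡n; m≤n+o⇒m∸n≤o; +-suc; +-comm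
        ; module ≤-Reasoning)
open import Data.Product using (∃-syntax; _×_; _,_; proj₁; proj₂)
open import Data.Sum using (_⊎_; inj₁; inj₂)
open import Function using (_∘_; _↔_; _⇔_; Inverse; Equivalence; mk↔ₛ′)
open import Relation.Binary.PropositionalEquality
  using (_≡_; _≢_; refl; sym; trans; cong; cong₂; subst; module ≡-Reasoning)
open import Relation.Nullary using (¬_; Dec; yes; no; contradiction)
open import Relation.Nullary.Decidable using (_×-dec_; _→-dec_; ¬?)

Adj-sym : ∀ {n} (G : Graph n) {a b} → Adj G a b → Adj G b a
Adj-sym G {a} {b} = trans (Graph.sym G b a)

Adj-irrefl : ∀ {n} (G : Graph n) {a} → ¬ Adj G a a
Adj-irrefl G {a} a~a with trans (sym a~a) (Graph.irrefl G a)
... | ()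

b≡e⊎b≡not-e : ∀ b e → b ≡ e ⊎ b ≡ not e
b≡e⊎b≡not-e false false = inj₁ refl
b≡e⊎b≡not-e false true = inj₂ refl
b≡e⊎b≡not-e true false = inj₂ refl
b≡e⊎b≡not-e true true = inj₁ refl

≤3+-split : ∀ {n M} → 1 ≤ M → n ≤ 3 + M → n ≤ suc M ⊎ ∃[ n′ ] (n ≡ 3 + n′ × n′ ≤ M)
≤3+-split {n} {M} 1≤M n≤3+M with n ≤? suc M
... | yes n≤1+M = inj₁ n≤1+M
... | no n≰1+M = inj₂ (n ∸ 3 , sym (m+[n∸m]≡n 3≤n) , m≤n+o⇒m∸n≤o n 3 n≤3+M)
  where
  3≤n : 3 ≤ n
  3≤n = ≤-trans (s≤s (s≤s 1≤M)) (≰⇒> n≰1+M)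

x∈p─q⇒x∉q : ∀ {n} {x : Fin n} (p q : Subset n) → x ∈ p ─ q → x ∉ q
x∈p─q⇒x∉q (_ ∷ p) (outside ∷ q) (there x∈) (there x∈q) = x∈p─q⇒x∉q p q x∈ x∈q
x∈p─q⇒x∉q (_ ∷ p) (inside ∷ q) (there x∈) (there x∈q) = x∈p─q⇒x∉q p q x∈ x∈q

x∉p-x : ∀ {n} {x : Fin n} (p : Subset n) → x ∉ p - x
x∉p-x {x = x} p x∈ = x∈p─q⇒x∉q p ⁅ x ⁆ x∈ (x∈⁅x⁆ x)

x∉p⇒p∪⁅x⁆-x≡p : ∀ {n} {x : Fin n} {p : Subset n} → x ∉ p → (p ∪ ⁅ x ⁆) - x ≡ p
x∉p⇒p∪⁅x⁆-x≡p {x = x} {p} x∉p = ⊆-antisym ⊆p p⊆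
  where
  ⊆p : (p ∪ ⁅ x ⁆) - x ⊆ p
  ⊆p y∈ with x∈p∪q⁻ p ⁅ x ⁆ (p─q⊆p _ _ y∈)
  ... | inj₁ y∈p = y∈p
  ... | inj₂ y∈⁅x⁆ = contradiction y∈⁅x⁆ (x∈p─q⇒x∉q _ _ y∈)
  p⊆ : p ⊆ (p ∪ ⁅ x ⁆) - x
  p⊆ {y} y∈p = x∈p∧x≢y⇒x∈p-y (p⊆p∪q ⁅ x ⁆ y∈p) λ { refl → x∉p y∈p }

x∈p⇒p-x∪⁅x⁆≡p : ∀ {n} {x : Fin n} {p : Subset n} → x ∈ p → (p - x) ∪ ⁅ x ⁆ ≡ p
x∈p⇒p-x∪⁅x⁆≡p {x = x} {p} x∈p = ⊆-antisym ⊆p p⊆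
  where
  ⊆p : (p - x) ∪ ⁅ x ⁆ ⊆ p
  ⊆p y∈ with x∈p∪q⁻ (p - x) ⁅ x ⁆ y∈
  ... | inj₁ y∈p-x = p─q⊆p _ _ y∈p-x
  ... | inj₂ y∈⁅x⁆ = subst (_∈ p) (sym (x∈⁅y⁆⇒x≡y x y∈⁅x⁆)) x∈p
  p⊆ : p ⊆ (p - x) ∪ ⁅ x ⁆
  p⊆ {y} y∈p with y ≟ x
  ... | yes refl = q⊆p∪q (p - x) ⁅ x ⁆ (x∈⁅x⁆ x)
  ... | no y≢x = p⊆p∪q ⁅ x ⁆ (x∈p∧x≢y⇒x∈p-y y∈p y≢x)

TARSAdj-sym : ∀ {n} (G : Graph n) {X Y : Subset n} → TARSAdj G X Y → TARSAdj G Y X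
TARSAdj-sym G {X} (X≢Y , inj₁ (w , w∉X , refl)) =
  (λ e → X≢Y (sym e)) ,
  inj₂ (inj₁ (w , q⊆p∪q X ⁅ w ⁆ (x∈⁅x⁆ w) , sym (x∉p⇒p∪⁅x⁆-x≡p w∉X)))
TARSAdj-sym G {X} (X≢Y , inj₂ (inj₁ (w , w∈X , refl))) =
  (λ e → X≢Y (sym e)) , inj₁ (w , x∉p-x X , sym (x∈p⇒p-x∪⁅x⁆≡p w∈X))
TARSAdj-sym G {X} (X≢Y , inj₂ (inj₂ (a , b , a∈X , b∈Y , b∉X , a~b , refl))) =
  (λ e → X≢Y (sym e)) ,
  inj₂ (inj₂ (b , a , b∈Y , a∈X , x∉p-x (X ∪ ⁅ b ⁆) , Adj-sym G a~b , sym back))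
  where
  back : ((((X ∪ ⁅ b ⁆) - a) ∪ ⁅ a ⁆) - b) ≡ X
  back = trans (cong (_- b) (x∈p⇒p-x∪⁅x⁆≡p (p⊆p∪q ⁅ b ⁆ a∈X))) (x∉p⇒p∪⁅x⁆-x≡p b∉X)

∷-TARSAdj : ∀ {n} {G : Graph (suc n)} a {S S′} →
  TARSAdj (induced G suc) S S′ → TARSAdj G (a ∷ S) (a ∷ S′)
∷-TARSAdj a {S} (S≢S′ , inj₁ (w , w∉S , refl)) =
  S≢S′ ∘ ∷-injectiveʳ , inj₁ (suc w , w∉S ∘ drop-there , sym (∷-∪-⁅suc⁆ S w))
  where
  ∷-∪-⁅suc⁆ : ∀ S w → (a ∷ S) ∪ ⁅ suc w ⁆ ≡ a ∷ (S ∪ ⁅ w ⁆)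
  ∷-∪-⁅suc⁆ S w = cong (_∷ S ∪ ⁅ w ⁆) (∨-identityʳ a)
∷-TARSAdj a (S≢S′ , inj₂ (inj₁ (w , w∈S , refl))) =
  S≢S′ ∘ ∷-injectiveʳ , inj₂ (inj₁ (suc w , there w∈S , refl))
∷-TARSAdj a {S} (S≢S′ , inj₂ (inj₂ (b , c , b∈S , c∈S′ , c∉S , b~c , refl))) =
  S≢S′ ∘ ∷-injectiveʳ ,
  inj₂ (inj₂ (suc b , suc c , there b∈S , there c∈S′ , c∉S ∘ drop-there , b~c ,
              cong (λ a′ → (a′ ∷ S ∪ ⁅ c ⁆) - suc b) (sym (∨-identityʳ a))))

DominatingExcept : ∀ {n} → Graph n → Fin n → Subset n → Set
DominatingExcept G x D = ∀ w → w ≢ x → w ∉ D → ∃[ z ] (z ∈ D × Adj G w z)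

dominatingExcept? : ∀ {n} (G : Graph n) (x : Fin n) (D : Subset n) → Dec (DominatingExcept G x D)
dominatingExcept? G x D =
  all? λ w → ¬? (w ≟ x) →-dec ¬? (w ∈? D) →-dec any? λ z → (z ∈? D) ×-dec (adj G w z ≟ᵇ true)

Dominating⇒DominatingExcept : ∀ {n} (G : Graph n) {D} x → Dominating G D → DominatingExcept G x D
Dominating⇒DominatingExcept G x d w _ = d w

DominatingExcept⇒Dominating : ∀ {n} (G : Graph n) {x D} → x ∈ D → DominatingExcept G x D → Dominating G D
DominatingExcept⇒Dominating G x∈D d w w∉D = d w (λ { refl → w∉D x∈D }) w∉D

DominatingExcept⇒Dominating∪ : ∀ {n} (G : Graph n) {x D} →
  DominatingExcept G x D → Dominating G (D ∪ ⁅ x ⁆)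
DominatingExcept⇒Dominating∪ G {x} {D} d w w∉ =
  let z , z∈D , w~z = d w w≢x (w∉ ∘ p⊆p∪q ⁅ x ⁆) in z , p⊆p∪q ⁅ x ⁆ z∈D , w~z
  where
  w≢x : w ≢ x
  w≢x refl = w∉ (q⊆p∪q D ⁅ x ⁆ (x∈⁅x⁆ x))

Dominating-mono : ∀ {n} (G : Graph n) {D D′} → D ⊆ D′ → Dominating G D → Dominating G D′
Dominating-mono G D⊆D′ d w w∉D′ with d w (w∉D′ ∘ D⊆D′)
... | z , z∈D , w~z = z , D⊆D′ z∈D , w~z

-- Counting dominating sets
Unique-⊆⇒length≤ : ∀ {A : Set} {xs ys : List A} → Unique xs →
  (∀ {z} → z ∈ₗ xs → z ∈ₗ ys) → length xs ≤ length ys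
Unique-⊆⇒length≤ {xs = []} _ _ = z≤n
Unique-⊆⇒length≤ {xs = x ∷ xs} (x∉xs ∷ u) xs⊆ys with ∈-∃++ (xs⊆ys (here refl))
... | ys₁ , ys₂ , refl = begin
  suc (length xs)                ≤⟨ s≤s (Unique-⊆⇒length≤ u xs⊆ys₁++ys₂) ⟩
  suc (length (ys₁ ++ ys₂))      ≡⟨ cong suc (length-++ ys₁) ⟩
  suc (length ys₁ + length ys₂)  ≡⟨ +-suc (length ys₁) (length ys₂) ⟨
  length ys₁ + length (x ∷ ys₂)  ≡⟨ length-++ ys₁ ⟨
  length (ys₁ ++ x ∷ ys₂)        ∎
  where
  open ≤-Reasoning
  xs⊆ys₁++ys₂ : ∀ {z} → z ∈ₗ xs → z ∈ₗ ys₁ ++ ys₂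
  xs⊆ys₁++ys₂ z∈xs with ∈-++⁻ ys₁ (xs⊆ys (there z∈xs))
  ... | inj₁ z∈ys₁ = ∈-++⁺ˡ z∈ys₁
  ... | inj₂ (here refl) = contradiction z∈xs (All¬⇒¬Any x∉xs)
  ... | inj₂ (there z∈ys₂) = ∈-++⁺ʳ ys₁ z∈ys₂

allSubsets-complete : ∀ {n} (S : Subset n) → S ∈ₗ allSubsets n
allSubsets-complete [] = here refl
allSubsets-complete (true ∷ S) = ∈-++⁺ˡ (∈-map⁺ (true ∷_) (allSubsets-complete S))
allSubsets-complete {suc n} (false ∷ S) =
  ∈-++⁺ʳ (map (true ∷_) (allSubsets n)) (∈-map⁺ (false ∷_) (allSubsets-complete S))

allSubsets-unique : ∀ n → Unique (allSubsets n)
allSubsets-unique zero = [] ∷ []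
allSubsets-unique (suc n) =
  Unique.++⁺ (Unique.map⁺ ∷-injectiveʳ (allSubsets-unique n))
             (Unique.map⁺ ∷-injectiveʳ (allSubsets-unique n)) disjoint
  where
  disjoint : ∀ {S} → ¬ (S ∈ₗ map (true ∷_) (allSubsets n) × S ∈ₗ map (false ∷_) (allSubsets n))
  disjoint (S∈₁ , S∈₂) with ∈-map⁻ (true ∷_) S∈₁ | ∈-map⁻ (false ∷_) S∈₂
  ... | _ , _ , refl | _ , _ , ()

dominatingSets : ∀ {n} → Graph n → List (Subset n)
dominatingSets {n} G = filter (dominating? G) (allSubsets n)

∈-dominatingSets : ∀ {n} (G : Graph n) {D} → Dominating G D → D ∈ₗ dominatingSets G
∈-dominatingSets G d = ∈-filter⁺ (dominating? G) (allSubsets-complete _) d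

complete⇒numDominating≤length : ∀ {n} (G : Graph n) {xs} → (∀ D → Dominating G D → D ∈ₗ xs) →
  numDominating G ≤ length xs
complete⇒numDominating≤length {n} G covers =
  Unique-⊆⇒length≤ (Unique.filter⁺ (dominating? G) (allSubsets-unique n))
  λ D∈ → covers _ (proj₂ (∈-filter⁻ (dominating? G) {xs = allSubsets n} D∈))

numDominating≤length⇒complete : ∀ {n} (G : Graph n) {xs} → Unique xs → All (Dominating G) xs →
  numDominating G ≤ length xs → ∀ D → Dominating G D → D ∈ₗ xs
numDominating≤length⇒complete G {xs} u ds long D d with Any.any? (≡-dec _≟ᵇ_ D) xs
... | yes D∈xs = D∈xs
... | no D∉xs = contradiction (≤-trans too-many long) (<-irrefl refl)
  where
  too-many : suc (length xs) ≤ numDominating G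
  too-many = Unique-⊆⇒length≤ (¬Any⇒All¬ xs D∉xs ∷ u) λ where
    (here refl) → ∈-dominatingSets G d
    (there D′∈) → ∈-dominatingSets G (All.lookup ds D′∈)

-- Walks, cycles and Hamiltonian paths
data Walk {A : Set} (R : A → A → Set) : A → List A → A → Set where
  [] : ∀ {x} → Walk R x [] x
  _∷_ : ∀ {x y ys z} → R x y → Walk R y ys z → Walk R x (y ∷ ys) z

_++ᵂ_ : ∀ {A : Set} {R : A → A → Set} {x ys y zs z} →
  Walk R x ys y → Walk R y zs z → Walk R x (ys ++ zs) z
[] ++ᵂ w = w
(r ∷ w₁) ++ᵂ w₂ = r ∷ (w₁ ++ᵂ w₂)

Walk-lookup : ∀ {A : Set} {R : A → A → Set} {x ys z} → Walk R x ys z →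
  ∀ (i : Fin (length ys)) → R (lookup (x ∷ ys) (inject₁ i)) (lookup (x ∷ ys) (suc i))
Walk-lookup (r ∷ w) zero = r
Walk-lookup (r ∷ w) (suc i) = Walk-lookup w i

Walk-last : ∀ {A : Set} {R : A → A → Set} {x ys z} → Walk R x ys z →
  lookup (x ∷ ys) (fromℕ (length ys)) ≡ z
Walk-last [] = refl
Walk-last (r ∷ w) = Walk-last w

tabulate-Walk : ∀ {A : Set} {R : A → A → Set} {k} (c : Fin (suc k) → A) →
  (∀ (i : Fin k) → R (c (inject₁ i)) (c (suc i))) →
  Walk R (c zero) (List.tabulate (c ∘ suc)) (c (fromℕ k))
tabulate-Walk {k = zero} c step = []
tabulate-Walk {k = suc k} c step = step zero ∷ tabulate-Walk (c ∘ suc) (step ∘ suc)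

Unique-lookup-injective : ∀ {A : Set} {xs : List A} → Unique xs →
  ∀ {i j} → lookup xs i ≡ lookup xs j → i ≡ j
Unique-lookup-injective (_ ∷ _) {zero} {zero} _ = refl
Unique-lookup-injective (x∉xs ∷ _) {zero} {suc j} e = contradiction e (All.lookup x∉xs (∈-lookup j))
Unique-lookup-injective (x∉xs ∷ _) {suc i} {zero} e = contradiction (sym e) (All.lookup x∉xs (∈-lookup i))
Unique-lookup-injective (_ ∷ u) {suc i} {suc j} e = cong suc (Unique-lookup-injective u e)

closedWalk⇒TARSCycle : ∀ {n} {G : Graph n} {x ys y} → Walk (TARSAdj G) x ys y → TARSAdj G y x →
  Unique (x ∷ ys) → All (Dominating G) (x ∷ ys) → TARSCycle G (length ys)
closedWalk⇒TARSCycle {G = G} {x} {ys} w y~x u ds = record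
  { c = lookup (x ∷ ys)
  ; dom = λ i → All.lookup ds (∈-lookup i)
  ; distinct = Unique-lookup-injective u
  ; step = Walk-lookup w
  ; close = subst (λ z → TARSAdj G z x) (sym (Walk-last w)) y~x
  }

record HamiltonianPath {n} (G : Graph n) : Set where
  field
    start finish : Subset n
    rest : List (Subset n)
    walk : Walk (TARSAdj G) start rest finish
    distinct : Unique (start ∷ rest)
    dominating : All (Dominating G) (start ∷ rest)
    complete : ∀ D → Dominating G D → D ∈ₗ start ∷ rest

⊤-dominating : ∀ {n} (G : Graph n) → Dominating G ⊤
⊤-dominating G w w∉⊤ = contradiction ∈⊤ w∉⊤

-- A dominating set D ≠ ⊤ misses some w and so lies in ⊤ - w, which is then dominating and adjacent to ⊤.
smallHamiltonianPath : ∀ {n} (G : Graph n) → numDominating G ≤ 2 → HamiltonianPath G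
smallHamiltonianPath {n} G N≤2 with any? (λ w → dominating? G (⊤ - w))
... | yes (w , ⊤-w-dominating) = record
  { walk = ⊤~⊤-w ∷ []
  ; distinct = distinct
  ; dominating = dominating
  ; complete = numDominating≤length⇒complete G distinct dominating N≤2
  }
  where
  ⊤~⊤-w : TARSAdj G ⊤ (⊤ - w)
  ⊤~⊤-w = (λ e → x∉p-x ⊤ (subst (w ∈_) e ∈⊤)) , inj₂ (inj₁ (w , ∈⊤ , refl))
  distinct : Unique (⊤ ∷ (⊤ - w) ∷ [])
  distinct = (proj₁ ⊤~⊤-w ∷ []) ∷ [] ∷ []
  dominating : All (Dominating G) (⊤ ∷ (⊤ - w) ∷ [])
  dominating = ⊤-dominating G ∷ ⊤-w-dominating ∷ []
... | no ¬⊤-w-dominating = record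
  { walk = []
  ; distinct = [] ∷ []
  ; dominating = ⊤-dominating G ∷ []
  ; complete = only-⊤
  }
  where
  only-⊤ : ∀ D → Dominating G D → D ∈ₗ ⊤ ∷ []
  only-⊤ D d with ≡-dec _≟ᵇ_ D ⊤
  ... | yes D≡⊤ = here D≡⊤
  ... | no D≢⊤ = contradiction (w , Dominating-mono G D⊆⊤-w d) ¬⊤-w-dominating
    where
    missing : ∃[ w ] w ∉ D
    missing = ¬∀⟶∃¬ n (_∈ D) (_∈? D) λ all∈D → D≢⊤ (⊆-antisym ⊆⊤ λ {w} _ → all∈D w)
    w : Fin n
    w = proj₁ missing
    D⊆⊤-w : D ⊆ ⊤ - w
    D⊆⊤-w z∈D = x∈p∧x≢y⇒x∈p-y ∈⊤ λ { refl → proj₂ missing z∈D }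

TARSCycle⇒HamiltonianPath : ∀ {n k} {G : Graph n} → TARSCycle G k → numDominating G ≤ suc k →
  HamiltonianPath G
TARSCycle⇒HamiltonianPath {G = G} C N≤ = record
  { walk = tabulate-Walk c step
  ; distinct = distinct
  ; dominating = dominating
  ; complete = numDominating≤length⇒complete G distinct dominating
                 (subst (numDominating G ≤_) (sym (length-tabulate c)) N≤)
  }
  where
  open TARSCycle C using (c; step; dom)
  distinct : Unique (List.tabulate c)
  distinct = Unique.tabulate⁺ (TARSCycle.distinct C)
  dominating : All (Dominating G) (List.tabulate c)
  dominating = Allₚ.tabulate⁺ dom

pancyclic⇒HamiltonianPath : ∀ {n} {G : Graph n} → TARSPancyclic G → HamiltonianPath G
pancyclic⇒HamiltonianPath {G = G} pan with numDominating G in N≡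
... | 0 = smallHamiltonianPath G (≤-trans (≤-reflexive N≡) z≤n)
... | 1 = smallHamiltonianPath G (≤-trans (≤-reflexive N≡) (s≤s z≤n))
... | 2 = smallHamiltonianPath G (≤-reflexive N≡)
... | suc (suc (suc k)) =
  TARSCycle⇒HamiltonianPath (pan (2 + k) (s≤s (s≤s (s≤s z≤n))) ≤-refl) (≤-reflexive N≡)

-- Relabelling vertices
module _ {k n} (H : Graph n) (σ : Fin k ↔ Fin n) where

  open Inverse σ using (to; from; strictlyInverseˡ; strictlyInverseʳ)

  private
    H′ : Graph k
    H′ = induced H to

  push : Subset k → Subset n
  push S = tabulate λ w → Vec.lookup S (from w)

  pull : Subset n → Subset k
  pull D = tabulate λ i → Vec.lookup D (to i)

  ∈-push⁺ : ∀ {S w} → from w ∈ S → w ∈ push S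
  ∈-push⁺ {S} {w} from-w∈S = lookup⇒[]= w (push S) (trans (lookup∘tabulate _ w) ([]=⇒lookup from-w∈S))

  ∈-push⁻ : ∀ {S w} → w ∈ push S → from w ∈ S
  ∈-push⁻ {S} {w} w∈ = lookup⇒[]= (from w) S (trans (sym (lookup∘tabulate _ w)) ([]=⇒lookup w∈))

  ∈-pull⁺ : ∀ {D i} → to i ∈ D → i ∈ pull D
  ∈-pull⁺ {D} {i} to-i∈D = lookup⇒[]= i (pull D) (trans (lookup∘tabulate _ i) ([]=⇒lookup to-i∈D))

  to-∈-push : ∀ {S i} → i ∈ S → to i ∈ push S
  to-∈-push {S} {i} i∈S = ∈-push⁺ (subst (_∈ S) (sym (strictlyInverseʳ i)) i∈S)

  to-∉-push : ∀ {S i} → i ∉ S → to i ∉ push S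
  to-∉-push {S} {i} i∉S = i∉S ∘ subst (_∈ S) (strictlyInverseʳ i) ∘ ∈-push⁻

  push∘pull : ∀ D → push (pull D) ≡ D
  push∘pull D = trans
    (tabulate-cong λ w → trans (lookup∘tabulate _ (from w)) (cong (Vec.lookup D) (strictlyInverseˡ w)))
    (tabulate∘lookup D)

  pull∘push : ∀ S → pull (push S) ≡ S
  pull∘push S = trans
    (tabulate-cong λ i → trans (lookup∘tabulate _ (to i)) (cong (Vec.lookup S) (strictlyInverseʳ i)))
    (tabulate∘lookup S)

  push-injective : ∀ {S S′} → push S ≡ push S′ → S ≡ S′
  push-injective {S} {S′} e = trans (sym (pull∘push S)) (trans (cong pull e) (pull∘push S′))

  push-zipWith : ∀ (_⊕_ : Bool → Bool → Bool) S T →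
    push (Vec.zipWith _⊕_ S T) ≡ Vec.zipWith _⊕_ (push S) (push T)
  push-zipWith _⊕_ S T = begin
    push (Vec.zipWith _⊕_ S T)
      ≡⟨ tabulate-cong (λ w → lookup-zipWith _⊕_ (from w) S T) ⟩
    tabulate (λ w → Vec.lookup S (from w) ⊕ Vec.lookup T (from w))
      ≡⟨ tabulate-cong (λ w → cong₂ _⊕_ (lookup∘tabulate _ w) (lookup∘tabulate _ w)) ⟨
    tabulate (λ w → Vec.lookup (push S) w ⊕ Vec.lookup (push T) w)
      ≡⟨ tabulate-cong (λ w → lookup-zipWith _⊕_ w (push S) (push T)) ⟨
    tabulate (Vec.lookup (Vec.zipWith _⊕_ (push S) (push T)))
      ≡⟨ tabulate∘lookup _ ⟩
    Vec.zipWith _⊕_ (push S) (push T) ∎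
    where open ≡-Reasoning

  push-⁅⁆ : ∀ i → push ⁅ i ⁆ ≡ ⁅ to i ⁆
  push-⁅⁆ i = ⊆-antisym ⊆⁅to-i⁆ ⁅to-i⁆⊆
    where
    ⊆⁅to-i⁆ : push ⁅ i ⁆ ⊆ ⁅ to i ⁆
    ⊆⁅to-i⁆ {w} w∈ with x∈⁅y⁆⇒x≡y i (∈-push⁻ w∈)
    ... | refl = subst (_∈ ⁅ to (from w) ⁆) (strictlyInverseˡ w) (x∈⁅x⁆ _)
    ⁅to-i⁆⊆ : ⁅ to i ⁆ ⊆ push ⁅ i ⁆
    ⁅to-i⁆⊆ w∈ with x∈⁅y⁆⇒x≡y (to i) w∈
    ... | refl = to-∈-push (x∈⁅x⁆ i)

  push-∪⁅⁆ : ∀ S i → push (S ∪ ⁅ i ⁆) ≡ push S ∪ ⁅ to i ⁆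
  push-∪⁅⁆ S i = trans (push-zipWith _∨_ S ⁅ i ⁆) (cong (push S ∪_) (push-⁅⁆ i))

  push-─⁅⁆ : ∀ S i → push (S - i) ≡ push S - to i
  push-─⁅⁆ S i = trans (push-zipWith _ S ⁅ i ⁆) (cong (push S ─_) (push-⁅⁆ i))

  push-TARSAdj : ∀ {S S′} → TARSAdj H′ S S′ → TARSAdj H (push S) (push S′)
  push-TARSAdj {S} (S≢S′ , inj₁ (w , w∉S , refl)) =
    S≢S′ ∘ push-injective , inj₁ (to w , to-∉-push w∉S , push-∪⁅⁆ S w)
  push-TARSAdj {S} (S≢S′ , inj₂ (inj₁ (w , w∈S , refl))) =
    S≢S′ ∘ push-injective , inj₂ (inj₁ (to w , to-∈-push w∈S , push-─⁅⁆ S w))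
  push-TARSAdj {S} (S≢S′ , inj₂ (inj₂ (a , b , a∈S , b∈S′ , b∉S , a~b , refl))) =
    S≢S′ ∘ push-injective ,
    inj₂ (inj₂ (to a , to b , to-∈-push a∈S , to-∈-push b∈S′ , to-∉-push b∉S , a~b ,
                trans (push-─⁅⁆ (S ∪ ⁅ b ⁆) a) (cong (_- to a) (push-∪⁅⁆ S b))))

  push-dominating : ∀ {S} → Dominating H′ S → Dominating H (push S)
  push-dominating d w w∉ with d (from w) (w∉ ∘ ∈-push⁺)
  ... | j , j∈S , from-w~j =
    to j , to-∈-push j∈S , subst (λ y → Adj H y (to j)) (strictlyInverseˡ w) from-w~j

  pull-dominating : ∀ {D} → Dominating H D → Dominating H′ (pull D)
  pull-dominating {D} d i i∉ with d (to i) (i∉ ∘ ∈-pull⁺)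
  ... | z , z∈D , to-i~z =
    from z , ∈-pull⁺ (subst (_∈ D) (sym (strictlyInverseˡ z)) z∈D) ,
    subst (Adj H (to i)) (sym (strictlyInverseˡ z)) to-i~z

  numDominating-relabel : numDominating H ≤ numDominating H′
  numDominating-relabel = subst (numDominating H ≤_) (length-map push (dominatingSets H′))
    (complete⇒numDominating≤length H λ D d →
      subst (_∈ₗ map push (dominatingSets H′)) (push∘pull D)
        (∈-map⁺ push (∈-dominatingSets H′ (pull-dominating d))))

  push-TARSCycle : ∀ {ℓ} → TARSCycle H′ ℓ → TARSCycle H ℓ
  push-TARSCycle C = record
    { c = push ∘ c
    ; dom = push-dominating ∘ dom
    ; distinct = distinct ∘ push-injective
    ; step = push-TARSAdj ∘ step
    ; close = push-TARSAdj close
    }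
    where open TARSCycle C

  TARSPancyclic-relabel : TARSPancyclic H′ → TARSPancyclic H
  TARSPancyclic-relabel pan ℓ 3≤ ℓ≤ = push-TARSCycle (pan ℓ 3≤ (≤-trans ℓ≤ numDominating-relabel))

relabel : ∀ {n m} → Fin n → Fin n → (Fin m → Fin n) → Fin (suc (suc m)) → Fin n
relabel u v f zero = u
relabel u v f (suc zero) = v
relabel u v f (suc (suc i)) = f i

relabel↔ : ∀ {n m} {u v : Fin n} {f : Fin m → Fin n} → u ≢ v → EnumeratesWithout f u v →
  Fin (suc (suc m)) ↔ Fin n
relabel↔ {n} {m} {u} {v} {f} u≢v (f-injective , f-avoids , f-onto) =
  mk↔ₛ′ g (proj₁ ∘ preimage) (proj₂ ∘ preimage) (λ i → g-injective (proj₂ (preimage (g i))))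
  where
  g : Fin (suc (suc m)) → Fin n
  g = relabel u v f
  preimage : ∀ w → ∃[ i ] g i ≡ w
  preimage w with w ≟ u | w ≟ v
  ... | yes refl | _ = zero , refl
  ... | no _ | yes refl = suc zero , refl
  ... | no w≢u | no w≢v = let i , fi≡w = f-onto w w≢u w≢v in suc (suc i) , fi≡w
  g-injective : ∀ {i j} → g i ≡ g j → i ≡ j
  g-injective {zero} {zero} _ = refl
  g-injective {zero} {suc zero} u≡v = contradiction u≡v u≢v
  g-injective {zero} {suc (suc j)} u≡fj = contradiction (sym u≡fj) (proj₁ (f-avoids j))
  g-injective {suc zero} {zero} v≡u = contradiction (sym v≡u) u≢v
  g-injective {suc zero} {suc zero} _ = refl
  g-injective {suc zero} {suc (suc j)} v≡fj = contradiction (sym v≡fj) (proj₂ (f-avoids j))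
  g-injective {suc (suc i)} {zero} fi≡u = contradiction fi≡u (proj₁ (f-avoids i))
  g-injective {suc (suc i)} {suc zero} fi≡v = contradiction fi≡v (proj₂ (f-avoids i))
  g-injective {suc (suc i)} {suc (suc j)} fi≡fj = cong (λ k → suc (suc k)) (f-injective fi≡fj)

-- Attaching a pendant path
module PendantPath {m} (G : Graph (suc (suc m))) (x : Fin m)
  (u~v : Adj G zero (suc zero))
  (u~x : Adj G zero (suc (suc x)))
  (u-adj⇒x : ∀ i → Adj G zero (suc (suc i)) → i ≡ x)
  (v-nonadj : ∀ i → ¬ Adj G (suc zero) (suc (suc i)))
  where

  pattern u = zero
  pattern v = suc zero

  G′ : Graph m
  G′ = induced G (λ i → suc (suc i))

  onV : Subset m → Subset (suc (suc m))
  onV S = false ∷ true ∷ S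

  onU : Bool → Subset m → Subset (suc (suc m))
  onU b S = true ∷ b ∷ S

  private
    lift-neighbour : ∀ {a b S i} → ∃[ j ] (j ∈ S × Adj G′ i j) →
      ∃[ z ] (z ∈ a ∷ b ∷ S × Adj G (suc (suc i)) z)
    lift-neighbour (j , j∈S , i~j) = suc (suc j) , there (there j∈S) , i~j

  onV-dominating : ∀ {S} → Dominating G′ S → Dominating G (onV S)
  onV-dominating d u _ = v , there here , u~v
  onV-dominating d v v∉ = contradiction (there here) v∉
  onV-dominating d (suc (suc i)) i∉ = lift-neighbour (d i λ i∈S → i∉ (there (there i∈S)))

  onU-dominating : ∀ {S} b → DominatingExcept G′ x S → Dominating G (onU b S)
  onU-dominating b d u u∉ = contradiction here u∉
  onU-dominating b d v _ = u , here , Adj-sym G u~v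
  onU-dominating b d (suc (suc i)) i∉ with i ≟ x
  ... | yes refl = u , here , Adj-sym G u~x
  ... | no i≢x = lift-neighbour (d i i≢x λ i∈S → i∉ (there (there i∈S)))

  onV-dominating⁻ : ∀ {S} → Dominating G (onV S) → Dominating G′ S
  onV-dominating⁻ d i i∉ with d (suc (suc i)) (i∉ ∘ drop-there ∘ drop-there)
  ... | v , _ , i~v = contradiction (Adj-sym G i~v) (v-nonadj i)
  ... | suc (suc j) , there (there j∈S) , i~j = j , j∈S , i~j

  onU-dominating⁻ : ∀ {b S} → Dominating G (onU b S) → DominatingExcept G′ x S
  onU-dominating⁻ d i i≢x i∉ with d (suc (suc i)) (i∉ ∘ drop-there ∘ drop-there)
  ... | u , _ , i~u = contradiction (u-adj⇒x i (Adj-sym G i~u)) i≢x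
  ... | v , _ , i~v = contradiction (Adj-sym G i~v) (v-nonadj i)
  ... | suc (suc j) , there (there j∈S) , i~j = j , j∈S , i~j

  ¬dominating-without-u-v : ∀ {S} → ¬ Dominating G (false ∷ false ∷ S)
  ¬dominating-without-u-v d with d v (λ { (there ()) })
  ... | v , there () , _
  ... | suc (suc j) , _ , v~j = v-nonadj j v~j

  Detour : Subset m → Set
  Detour T = x ∈ T × DominatingExcept G′ x (T - x) × ¬ Dominating G′ (T - x)

  detour? : ∀ T → Dec (Detour T)
  detour? T = (x ∈? T) ×-dec dominatingExcept? G′ x (T - x) ×-dec ¬? (dominating? G′ (T - x))

  data Over (T : Subset m) : Subset (suc (suc m)) → Set where
    v-layer : Over T (onV T)
    u-layer : ∀ b → Over T (onU b T)
    detour-layer : Detour T → ∀ b → Over T (onU b (T - x))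

  Over-dominating : ∀ {T D} → Dominating G′ T → Over T D → Dominating G D
  Over-dominating d v-layer = onV-dominating d
  Over-dominating d (u-layer b) = onU-dominating b (Dominating⇒DominatingExcept G′ x d)
  Over-dominating d (detour-layer (_ , d′ , _) b) = onU-dominating b d′

  dominating⇒Over : ∀ {D} → Dominating G D → ∃[ T ] (Dominating G′ T × Over T D)
  dominating⇒Over {false ∷ false ∷ S} d = contradiction d ¬dominating-without-u-v
  dominating⇒Over {false ∷ true ∷ S} d = S , onV-dominating⁻ d , v-layer
  dominating⇒Over {true ∷ b ∷ S} d with dominating? G′ S
  ... | yes dS = S , dS , u-layer b
  ... | no ¬dS = S ∪ ⁅ x ⁆ , DominatingExcept⇒Dominating∪ G′ dS′ ,
                 subst (Over (S ∪ ⁅ x ⁆) ∘ onU b) S∪x-x≡S (detour-layer detour b)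
    where
    dS′ : DominatingExcept G′ x S
    dS′ = onU-dominating⁻ d
    S∪x-x≡S : (S ∪ ⁅ x ⁆) - x ≡ S
    S∪x-x≡S = x∉p⇒p∪⁅x⁆-x≡p λ x∈S → ¬dS (DominatingExcept⇒Dominating G′ x∈S dS′)
    detour : Detour (S ∪ ⁅ x ⁆)
    detour = q⊆p∪q S ⁅ x ⁆ (x∈⁅x⁆ x) ,
             subst (DominatingExcept G′ x) (sym S∪x-x≡S) dS′ ,
             subst (¬_ ∘ Dominating G′) (sym S∪x-x≡S) ¬dS

  -- The equation D ≡ D′ is a separate argument because T - x is not a pattern to unify with.
  Over-injective : ∀ {T T′ D D′} → Dominating G′ T → Dominating G′ T′ →
    Over T D → Over T′ D′ → D ≡ D′ → T ≡ T′
  Over-injective _ _ v-layer v-layer refl = refl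
  Over-injective _ _ (u-layer b) (u-layer b′) refl = refl
  Over-injective dT _ (u-layer b) (detour-layer (_ , _ , ¬d) b′) refl = contradiction dT ¬d
  Over-injective _ dT′ (detour-layer (_ , _ , ¬d) b) (u-layer b′) refl = contradiction dT′ ¬d
  Over-injective {T} {T′} _ _ (detour-layer (x∈T , _) b) (detour-layer (x∈T′ , _) b′) e = begin
    T                 ≡⟨ x∈p⇒p-x∪⁅x⁆≡p x∈T ⟨
    (T - x) ∪ ⁅ x ⁆   ≡⟨ cong (_∪ ⁅ x ⁆) (∷-injectiveʳ (∷-injectiveʳ e)) ⟩
    (T′ - x) ∪ ⁅ x ⁆  ≡⟨ x∈p⇒p-x∪⁅x⁆≡p x∈T′ ⟩
    T′                ∎
    where open ≡-Reasoning

  lift-TARSAdj : ∀ a b {S S′} → TARSAdj G′ S S′ → TARSAdj G (a ∷ b ∷ S) (a ∷ b ∷ S′)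
  lift-TARSAdj a b S~S′ = ∷-TARSAdj {G = G} a (∷-TARSAdj {G = induced G suc} b S~S′)

  onV→onU : ∀ {S} → TARSAdj G (onV S) (onU false S)
  onV→onU {S} = (λ ()) , inj₂ (inj₂ (v , u , there here , here , (λ ()) , Adj-sym G u~v ,
    cong (λ S′ → true ∷ false ∷ S′) (sym (trans (p─⊥≡p _) (∪-identityʳ S)))))

  onV→onU-both : ∀ {S} → TARSAdj G (onV S) (onU true S)
  onV→onU-both {S} =
    (λ ()) , inj₁ (u , (λ ()) , cong (λ S′ → true ∷ true ∷ S′) (sym (∪-identityʳ S)))

  onU-flip : ∀ b {S} → TARSAdj G (onU b S) (onU (not b) S)
  onU-flip false {S} =
    (λ ()) , inj₁ (v , (λ { (there ()) }) , cong (λ S′ → true ∷ true ∷ S′) (sym (∪-identityʳ S)))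
  onU-flip true = TARSAdj-sym G (onU-flip false)

  onU→onV : ∀ b {S} → TARSAdj G (onU b S) (onV S)
  onU→onV false = TARSAdj-sym G onV→onU
  onU→onV true = TARSAdj-sym G onV→onU-both

  onV→detour : ∀ {T} → x ∈ T → TARSAdj G (onV T) (onU true (T - x))
  onV→detour {T} x∈T = (λ ()) ,
    inj₂ (inj₂ (suc (suc x) , u , there (there x∈T) , here , (λ ()) , Adj-sym G u~x ,
                cong (λ S′ → true ∷ true ∷ (S′ - x)) (sym (∪-identityʳ T))))

  detour-TARSAdj : ∀ {T} → x ∈ T → ∀ b → TARSAdj G (onU b T) (onU b (T - x))
  detour-TARSAdj {T} x∈T b =
    lift-TARSAdj true b ((λ e → x∉p-x T (subst (x ∈_) e x∈T)) , inj₂ (inj₁ (x , x∈T , refl)))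

  data Turn (T : Subset m) : ℕ → Set where
    turn₀ : Turn T 0
    turn₁ : Turn T 1
    turn₂ : Detour T → Turn T 2
    turn₃ : Detour T → Turn T 3

  data Step (T : Subset m) : ℕ → Set where
    pass : Step T 0
    flip : Step T 1
    detour : Detour T → Step T 3

  -- A plan along the path T ∷ Ts for a cycle of 2 + n vertices; the index of a Turn or Step counts
  -- the vertices spent at that set of the path beyond its v-lift and one u-lift.
  data Plan : Subset m → List (Subset m) → ℕ → Set where
    turn : ∀ {T Ts b} → Turn T b → Plan T Ts b
    step : ∀ {T T′ Ts k n} → Step T k → Plan T′ Ts n → Plan T (T′ ∷ Ts) (2 + k + n)

  turnRoute : ∀ {T b} → Turn T b → List (Subset (suc (suc m)))
  turnRoute {T} turn₀ = onU false T ∷ []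
  turnRoute {T} turn₁ = onU false T ∷ onU true T ∷ []
  turnRoute {T} (turn₂ _) = onU true (T - x) ∷ onU false (T - x) ∷ onU false T ∷ []
  turnRoute {T} (turn₃ _) = onU true (T - x) ∷ onU false (T - x) ∷ onU false T ∷ onU true T ∷ []

  turnExit : ∀ {T b} → Turn T b → Bool
  turnExit turn₀ = false
  turnExit turn₁ = true
  turnExit (turn₂ _) = false
  turnExit (turn₃ _) = true

  stepRoute : ∀ {T k} → Step T k → Bool → List (Subset (suc (suc m)))
  stepRoute {T} pass e = onU e T ∷ []
  stepRoute {T} flip e = onU e T ∷ onU (not e) T ∷ []
  stepRoute {T} (detour _) e = onU e T ∷ onU e (T - x) ∷ onU (not e) (T - x) ∷ onU (not e) T ∷ []

  stepExit : ∀ {T k} → Step T k → Bool → Bool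
  stepExit pass e = e
  stepExit flip e = not e
  stepExit (detour _) e = not e

  exit : ∀ {T Ts n} → Plan T Ts n → Bool
  exit (turn t) = turnExit t
  exit (step s p) = stepExit s (exit p)

  route : ∀ {T Ts n} → Plan T Ts n → List (Subset (suc (suc m)))
  route (turn t) = turnRoute t
  route (step {T′ = T′} s p) = onV T′ ∷ route p ++ stepRoute s (exit p)

  ladder : ∀ {T Ts n} → Plan T Ts n → List (Subset (suc (suc m)))
  ladder {T} p = onV T ∷ route p

  length-route : ∀ {T Ts n} (p : Plan T Ts n) → length (route p) ≡ suc n
  length-route (turn turn₀) = refl
  length-route (turn turn₁) = refl
  length-route (turn (turn₂ _)) = refl
  length-route (turn (turn₃ _)) = refl
  length-route (step {k = k} {n} s p) = begin
    suc (length (route p ++ stepRoute s (exit p)))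
      ≡⟨ cong suc (length-++ (route p)) ⟩
    suc (length (route p) + length (stepRoute s (exit p)))
      ≡⟨ cong₂ (λ a b → suc (a + b)) (length-route p) (length-stepRoute s) ⟩
    suc (suc n + suc k)
      ≡⟨ cong (λ z → suc (suc z)) (trans (+-suc n k) (cong suc (+-comm n k))) ⟩
    suc (2 + k + n) ∎
    where
    open ≡-Reasoning
    length-stepRoute : ∀ {T k} (s : Step T k) {e} → length (stepRoute s e) ≡ suc k
    length-stepRoute pass = refl
    length-stepRoute flip = refl
    length-stepRoute (detour _) = refl

  route-walk : ∀ {T Ts z n} → Walk (TARSAdj G′) T Ts z → (p : Plan T Ts n) →
    Walk (TARSAdj G) (onV T) (route p) (onU (exit p) T)
  route-walk _ (turn t) = turn-walk t
    where
    turn-walk : ∀ {T b} (t : Turn T b) → Walk (TARSAdj G) (onV T) (turnRoute t) (onU (turnExit t) T)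
    turn-walk turn₀ = onV→onU ∷ []
    turn-walk turn₁ = onV→onU ∷ onU-flip false ∷ []
    turn-walk (turn₂ (x∈T , _)) =
      onV→detour x∈T ∷ onU-flip true ∷ TARSAdj-sym G (detour-TARSAdj x∈T false) ∷ []
    turn-walk (turn₃ (x∈T , _)) =
      onV→detour x∈T ∷ onU-flip true ∷ TARSAdj-sym G (detour-TARSAdj x∈T false) ∷ onU-flip false ∷ []
  route-walk (T~T′ ∷ walk) (step s p) =
    lift-TARSAdj false true T~T′ ∷ (route-walk walk p ++ᵂ step-walk s (exit p) (TARSAdj-sym G′ T~T′))
    where
    step-walk : ∀ {T T′ k} (s : Step T k) e → TARSAdj G′ T′ T →
      Walk (TARSAdj G) (onU e T′) (stepRoute s e) (onU (stepExit s e) T)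
    step-walk pass e T′~T = lift-TARSAdj true e T′~T ∷ []
    step-walk flip e T′~T = lift-TARSAdj true e T′~T ∷ onU-flip e ∷ []
    step-walk (detour (x∈T , _)) e T′~T =
      lift-TARSAdj true e T′~T ∷ detour-TARSAdj x∈T e ∷ onU-flip e ∷
      TARSAdj-sym G (detour-TARSAdj x∈T (not e)) ∷ []

  OverPath : List (Subset m) → Subset (suc (suc m)) → Set
  OverPath Ts D = Any (λ T → Over T D) Ts

  turn-over : ∀ {T b} (t : Turn T b) → All (Over T) (turnRoute t)
  turn-over turn₀ = u-layer false ∷ []
  turn-over turn₁ = u-layer false ∷ u-layer true ∷ []
  turn-over (turn₂ d) = detour-layer d true ∷ detour-layer d false ∷ u-layer false ∷ []
  turn-over (turn₃ d) = detour-layer d true ∷ detour-layer d false ∷ u-layer false ∷ u-layer true ∷ []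

  step-over : ∀ {T k} (s : Step T k) e → All (Over T) (stepRoute s e)
  step-over pass e = u-layer e ∷ []
  step-over flip e = u-layer e ∷ u-layer (not e) ∷ []
  step-over (detour d) e = u-layer e ∷ detour-layer d e ∷ detour-layer d (not e) ∷ u-layer (not e) ∷ []

  ladder-over : ∀ {T Ts n} (p : Plan T Ts n) → All (OverPath (T ∷ Ts)) (ladder p)
  ladder-over (turn t) = here v-layer ∷ All.map here (turn-over t)
  ladder-over (step s p) =
    here v-layer ∷ Allₚ.++⁺ (All.map there (ladder-over p)) (All.map here (step-over s (exit p)))

  ladder-dominating : ∀ {T Ts n} → All (Dominating G′) (T ∷ Ts) → (p : Plan T Ts n) →
    All (Dominating G) (ladder p)
  ladder-dominating doms p = All.map dominating (ladder-over p)
    where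
    dominating : ∀ {D} → OverPath _ D → Dominating G D
    dominating over with find over
    ... | T , T∈ , T-over = Over-dominating (All.lookup doms T∈) T-over

  Over-apart : ∀ {T Ts D} → Dominating G′ T → All (Dominating G′) Ts → T ∉ₗ Ts →
    Over T D → ¬ OverPath Ts D
  Over-apart dT doms T∉Ts T-over over with find over
  ... | T′ , T′∈Ts , T′-over =
    T∉Ts (subst (_∈ₗ _) (sym (Over-injective dT (All.lookup doms T′∈Ts) T-over T′-over refl)) T′∈Ts)

  onU-≢-not : ∀ {b S S′} → onU b S ≢ onU (not b) S′
  onU-≢-not e = not-¬ refl (∷-injectiveˡ (∷-injectiveʳ e))

  detour-≢ : ∀ {T b b′} → x ∈ T → onU b (T - x) ≢ onU b′ T
  detour-≢ {T} x∈T e = x∉p-x T (subst (x ∈_) (sym (∷-injectiveʳ (∷-injectiveʳ e))) x∈T)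

  turn-unique : ∀ {T b} (t : Turn T b) → Unique (onV T ∷ turnRoute t)
  turn-unique turn₀ = ((λ ()) ∷ []) ∷ [] ∷ []
  turn-unique turn₁ = ((λ ()) ∷ (λ ()) ∷ []) ∷ ((λ ()) ∷ []) ∷ [] ∷ []
  turn-unique (turn₂ (x∈T , _)) =
    ((λ ()) ∷ (λ ()) ∷ (λ ()) ∷ []) ∷
    ((λ ()) ∷ detour-≢ x∈T ∷ []) ∷
    (detour-≢ x∈T ∷ []) ∷ [] ∷ []
  turn-unique (turn₃ (x∈T , _)) =
    ((λ ()) ∷ (λ ()) ∷ (λ ()) ∷ (λ ()) ∷ []) ∷
    ((λ ()) ∷ detour-≢ x∈T ∷ detour-≢ x∈T ∷ []) ∷
    (detour-≢ x∈T ∷ detour-≢ x∈T ∷ []) ∷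
    ((λ ()) ∷ []) ∷ [] ∷ []

  step-unique : ∀ {T k} (s : Step T k) e → Unique (stepRoute s e)
  step-unique pass e = [] ∷ []
  step-unique flip e = (onU-≢-not ∷ []) ∷ [] ∷ []
  step-unique (detour (x∈T , _)) e =
    (T≢T-x ∷ T≢T-x ∷ onU-≢-not ∷ []) ∷
    (onU-≢-not ∷ detour-≢ x∈T ∷ []) ∷
    (detour-≢ x∈T ∷ []) ∷ [] ∷ []
    where
    T≢T-x : ∀ {b b′} → onU b _ ≢ onU b′ _
    T≢T-x = detour-≢ x∈T ∘ sym

  onV-∉-stepRoute : ∀ {T T′ k} (s : Step T′ k) e → All (onV T ≢_) (stepRoute s e)
  onV-∉-stepRoute pass e = (λ ()) ∷ []
  onV-∉-stepRoute flip e = (λ ()) ∷ (λ ()) ∷ []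
  onV-∉-stepRoute (detour _) e = (λ ()) ∷ (λ ()) ∷ (λ ()) ∷ (λ ()) ∷ []

  ladder-unique : ∀ {T Ts n} → All (Dominating G′) (T ∷ Ts) → Unique (T ∷ Ts) → (p : Plan T Ts n) →
    Unique (ladder p)
  ladder-unique _ _ (turn t) = turn-unique t
  ladder-unique {T} (dT ∷ doms) (T∉Ts ∷ distinct) (step s p) =
    Allₚ.++⁺ (All.map onV-∉-ladder (ladder-over p)) (onV-∉-stepRoute s (exit p)) ∷
    Unique.++⁺ (ladder-unique doms distinct p) (step-unique s (exit p)) disjoint
    where
    apart : ∀ {D} → Over T D → ¬ OverPath _ D
    apart = Over-apart dT doms (All¬⇒¬Any T∉Ts)
    onV-∉-ladder : ∀ {D} → OverPath _ D → onV T ≢ D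
    onV-∉-ladder over refl = apart v-layer over
    disjoint : ∀ {D} → ¬ (D ∈ₗ ladder p × D ∈ₗ stepRoute s (exit p))
    disjoint (D∈ladder , D∈step) =
      apart (All.lookup (step-over s (exit p)) D∈step) (All.lookup (ladder-over p) D∈ladder)

  capacityᵈ : ∀ {T} → Dec (Detour T) → ℕ
  capacityᵈ (yes _) = 3
  capacityᵈ (no _) = 1

  capacity : Subset m → List (Subset m) → ℕ
  capacity T [] = capacityᵈ (detour? T)
  capacity T (T′ ∷ Ts) = 2 + capacityᵈ (detour? T) + capacity T′ Ts

  1≤capacity : ∀ T Ts → 1 ≤ capacity T Ts
  1≤capacity T [] with detour? T
  ... | yes _ = s≤s z≤n
  ... | no _ = s≤s z≤n
  1≤capacity T (_ ∷ _) = s≤s z≤n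

  fullTurn : ∀ {T} (d : Dec (Detour T)) → Turn T (capacityᵈ d)
  fullTurn (yes d) = turn₃ d
  fullTurn (no _) = turn₁

  fullStep : ∀ {T} (d : Dec (Detour T)) → Step T (capacityᵈ d)
  fullStep (yes d) = detour d
  fullStep (no _) = flip

  fullPlan : ∀ T Ts → Plan T Ts (capacity T Ts)
  fullPlan T [] = turn (fullTurn (detour? T))
  fullPlan T (T′ ∷ Ts) = step (fullStep (detour? T)) (fullPlan T′ Ts)

  fullTurn-complete : ∀ {T D} (d : Dec (Detour T)) → Over T D → D ∈ₗ onV T ∷ turnRoute (fullTurn d)
  fullTurn-complete _ v-layer = here refl
  fullTurn-complete (yes _) (u-layer false) = there (there (there (here refl)))
  fullTurn-complete (yes _) (u-layer true) = there (there (there (there (here refl))))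
  fullTurn-complete (yes _) (detour-layer _ true) = there (here refl)
  fullTurn-complete (yes _) (detour-layer _ false) = there (there (here refl))
  fullTurn-complete (no _) (u-layer false) = there (here refl)
  fullTurn-complete (no _) (u-layer true) = there (there (here refl))
  fullTurn-complete (no ¬d) (detour-layer d _) = contradiction d ¬d

  fullStep-complete : ∀ {T D} (d : Dec (Detour T)) e → Over T D → D ∈ₗ onV T ∷ stepRoute (fullStep d) e
  fullStep-complete _ _ v-layer = here refl
  fullStep-complete (yes _) e (u-layer b) with b≡e⊎b≡not-e b e
  ... | inj₁ refl = there (here refl)
  ... | inj₂ refl = there (there (there (there (here refl))))
  fullStep-complete (yes _) e (detour-layer _ b) with b≡e⊎b≡not-e b e
  ... | inj₁ refl = there (there (here refl))
  ... | inj₂ refl = there (there (there (here refl)))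
  fullStep-complete (no _) e (u-layer b) with b≡e⊎b≡not-e b e
  ... | inj₁ refl = there (here refl)
  ... | inj₂ refl = there (there (here refl))
  fullStep-complete (no ¬d) _ (detour-layer d _) = contradiction d ¬d

  fullPlan-complete : ∀ {T Ts D} → OverPath (T ∷ Ts) D → D ∈ₗ ladder (fullPlan T Ts)
  fullPlan-complete {T} {[]} (here over) = fullTurn-complete (detour? T) over
  fullPlan-complete {T} {T′ ∷ Ts} (here over) with fullStep-complete (detour? T) (exit (fullPlan T′ Ts)) over
  ... | here D≡onV-T = here D≡onV-T
  ... | there D∈step = there (∈-++⁺ʳ (ladder (fullPlan T′ Ts)) D∈step)
  fullPlan-complete {Ts = _ ∷ _} (there over) = there (∈-++⁺ˡ (fullPlan-complete over))

  plan : ∀ T Ts n → n ≤ capacity T Ts → Plan T Ts n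
  plan T [] n n≤ = turn (turnTo (detour? T) n≤)
    where
    turnTo : ∀ {n} (d : Dec (Detour T)) → n ≤ capacityᵈ d → Turn T n
    turnTo {0} _ _ = turn₀
    turnTo {1} _ _ = turn₁
    turnTo {2} (yes d) _ = turn₂ d
    turnTo {3} (yes d) _ = turn₃ d
    turnTo {suc (suc (suc (suc _)))} (yes _) (s≤s (s≤s (s≤s ())))
    turnTo {suc (suc _)} (no _) (s≤s ())
  plan T (T′ ∷ Ts) 0 _ = turn turn₀
  plan T (T′ ∷ Ts) 1 _ = turn turn₁
  plan T (T′ ∷ Ts) (suc (suc n)) (s≤s (s≤s n≤)) = stepTo (detour? T) n≤
    where
    M : ℕ
    M = capacity T′ Ts
    passOrFlip : ∀ {n} → n ≤ suc M → Plan T (T′ ∷ Ts) (2 + n)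
    passOrFlip n≤ with m≤n⇒m<n∨m≡n n≤
    ... | inj₁ (s≤s n≤M) = step pass (plan T′ Ts _ n≤M)
    ... | inj₂ refl = step flip (plan T′ Ts M ≤-refl)
    stepTo : ∀ (d : Dec (Detour T)) → n ≤ capacityᵈ d + M → Plan T (T′ ∷ Ts) (2 + n)
    stepTo (no _) n≤ = passOrFlip n≤
    stepTo (yes d) n≤ with ≤3+-split (1≤capacity T′ Ts) n≤
    ... | inj₁ n≤1+M = passOrFlip n≤1+M
    ... | inj₂ (n′ , refl , n′≤M) = step (detour d) (plan T′ Ts n′ n′≤M)

  numDominating≤2+capacity : (P : HamiltonianPath G′) →
    let open HamiltonianPath P in numDominating G ≤ 2 + capacity start rest
  numDominating≤2+capacity P = subst (numDominating G ≤_) (cong suc (length-route (fullPlan start rest)))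
    (complete⇒numDominating≤length G λ D d →
      let T , dT , T-over = dominating⇒Over d
      in fullPlan-complete (Any.map (λ { refl → T-over }) (complete T dT)))
    where open HamiltonianPath P

  ladder-cycle : (P : HamiltonianPath G′) → ∀ {n} →
    let open HamiltonianPath P in n ≤ capacity start rest → TARSCycle G (suc n)
  ladder-cycle P n≤ = subst (TARSCycle G) (length-route p)
    (closedWalk⇒TARSCycle (route-walk walk p) (onU→onV (exit p))
      (ladder-unique dominating distinct p) (ladder-dominating dominating p))
    where
    open HamiltonianPath P
    p : Plan start rest _
    p = plan start rest _ n≤

  pancyclic : TARSPancyclic G′ → TARSPancyclic G
  pancyclic pan 0 (s≤s ())
  pancyclic pan (suc n) _ ℓ≤N =
    ladder-cycle P (s≤s⁻¹ (s≤s⁻¹ (≤-trans ℓ≤N (numDominating≤2+capacity P))))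
    where
    P : HamiltonianPath G′
    P = pancyclic⇒HamiltonianPath pan

mainTheorem6 : ∀ {n m} (H : Graph n) (u v x : Fin n) →
    x ≢ v →
    (∀ w → (Adj H u w ⇔ (w ≡ x ⊎ w ≡ v))) →
    (∀ w → (Adj H v w ⇔ w ≡ u)) →
    (f : Fin m → Fin n) → EnumeratesWithout f u v →
    TARSPancyclic (induced H f) → TARSPancyclic H
mainTheorem6 H u v x x≢v N[u] N[v] f enum@(f-injective , f-avoids , f-onto) pan =
  TARSPancyclic-relabel H (relabel↔ u≢v enum)
    (PendantPath.pancyclic (induced H (relabel u v f)) ix
      u~v (subst (Adj H u) (sym fix≡x) u~x) u-adj⇒ix v-nonadj pan)
  where
  u~v : Adj H u v
  u~v = Equivalence.from (N[u] v) (inj₂ refl)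
  u~x : Adj H u x
  u~x = Equivalence.from (N[u] x) (inj₁ refl)
  u≢v : u ≢ v
  u≢v refl = Adj-irrefl H u~v
  x≢u : x ≢ u
  x≢u refl = Adj-irrefl H u~x
  ix : Fin _
  ix = proj₁ (f-onto x x≢u x≢v)
  fix≡x : f ix ≡ x
  fix≡x = proj₂ (f-onto x x≢u x≢v)
  u-adj⇒ix : ∀ i → Adj H u (f i) → i ≡ ix
  u-adj⇒ix i u~fi with Equivalence.to (N[u] (f i)) u~fi
  ... | inj₁ fi≡x = f-injective (trans fi≡x (sym fix≡x))
  ... | inj₂ fi≡v = contradiction fi≡v (proj₂ (f-avoids i))
  v-nonadj : ∀ i → ¬ Adj H v (f i)
  v-nonadj i v~fi = proj₁ (f-avoids i) (Equivalence.to (N[v] (f i)) v~fi)
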